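{- Let $n$ and $\Delta\ge 3$ be integers and let $T$ be a tree with $n$ vertices and maximum degree $\Delta$. Then $$TW(T)\ge (n-1)(\Delta-1),$$ with equality if and only if $T$ is starlike (of order $n$ with maximum degree $\Delta$).
   Context: A pendent vertex is a vertex of degree $1$; the terminal Wiener index $TW(T)$ of a tree $T$ is the sum of distances over all unordered pairs of distinct pendent vertices of $T$. A tree is starlike of degree $k$ if exactly one of its vertices has degree greater than two, and that degree equals $k\ge 3$. -}

module Defs where

open import Data.Nat using (ℕ; zero; suc; _+_; _*_; _∸_; _≤_; _<_; _<ᵇ_)
open import Data.Bool using (Bool; true; false; _∨_; _∧_; if_then_else_; not)
open import Data.Fin using (Fin; toℕ; inject₁; fromℕ) renaming (zero to fzero; suc to fsuc)
open import Data.List using (List; []; _∷_; map; allFin; concatMap)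
open import Data.Nat.ListAction using (sum)
open import Data.Bool.ListAction using (any)
open import Data.Product using (Σ; ∃; _×_; _,_)
open import Relation.Binary.PropositionalEquality using (_≡_)
open import Relation.Nullary using (¬_; does)
open import Data.Fin.Properties using (_≟_)
open import Function.Bundles using (_⇔_)
open import Function.Definitions using (Injective)

record Graph (n : ℕ) : Set where
  field
    adj   : Fin n → Fin n → Bool
    sym   : ∀ u v → adj u v ≡ adj v u
    irref : ∀ v → adj v v ≡ false
open Graph public

module _ {n : ℕ} (G : Graph n) where

  data Walk : Fin n → Fin n → Set where
    here : ∀ {u} → Walk u u
    step : ∀ {u w v} → adj G u w ≡ true → Walk w v → Walk u v

  Connected : Set
  Connected = ∀ u v → Walk u v

  -- A cycle of length m+3: an injective cyclic sequence of vertices,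
  -- consecutive ones adjacent (including the last to the first).
  record Cycle : Set where
    field
      m     : ℕ
      vert  : Fin (suc (suc (suc m))) → Fin n
      inj   : Injective _≡_ _≡_ vert
      edges : ∀ (i : Fin (suc (suc m))) → adj G (vert (inject₁ i)) (vert (fsuc i)) ≡ true
      close : adj G (vert (fromℕ (suc (suc m)))) (vert fzero) ≡ true

  Acyclic : Set
  Acyclic = ¬ Cycle

  IsTree : Set
  IsTree = Connected × Acyclic

  deg : Fin n → ℕ
  deg v = sum (map (λ w → if adj G v w then 1 else 0) (allFin n))

  Pendent : Fin n → Set
  Pendent v = deg v ≡ 1

  isPendentᵇ : Fin n → Bool
  isPendentᵇ v with deg v
  ... | 1 = true
  ... | _ = false

  within : ℕ → Fin n → Fin n → Bool
  within zero    u v = does (u ≟ v)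
  within (suc k) u v = within k u v ∨ any (λ w → within k u w ∧ adj G w v) (allFin n)

  -- Shortest-path distance: the least k with within k u v = true,
  -- computed as the number of k < n with within k u v = false
  -- (within is monotone in k; in a connected graph on n vertices
  -- within (n ∸ 1) u v = true, so this is exactly the distance).
  dist : Fin n → Fin n → ℕ
  dist u v = sum (map (λ k → if within (toℕ k) u v then 0 else 1) (allFin n))

  -- Terminal Wiener index: sum of distances over unordered pairs {u,v},
  -- u ≠ v (encoded as toℕ u < toℕ v), of pendent vertices.
  TW : ℕ
  TW = sum (concatMap (λ u → map (λ v →
         if (toℕ u <ᵇ toℕ v) ∧ isPendentᵇ u ∧ isPendentᵇ v then dist u v else 0)
         (allFin n)) (allFin n))

  MaxDegree : ℕ → Set
  MaxDegree Δ = (∃ λ v → deg v ≡ Δ) × (∀ v → deg v ≤ Δ)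

  Starlike : ℕ → Set
  Starlike k = ∃ λ v → (deg v ≡ k) × (2 < deg v) × (∀ w → 2 < deg w → w ≡ v)

-- Induct on the order n by removing a leaf ℓ with neighbour p; let L be the number of leaves
-- and A(c) the sum of the distances from c to the leaves. Distances to ℓ exceed those to p by
-- one, so TW(T) = TW(T − ℓ) + (L − 1) when p becomes a leaf of T − ℓ, and
-- TW(T) = TW(T − ℓ) + (L − 1) + A_{T − ℓ}(p) otherwise. The same removal shows A(c) ≥ n − 1,
-- with equality iff no vertex other than c has degree ≥ 3, and L = 2 + Σ_v (deg v − 2)⁺.
-- Hence TW(T) ≥ (n − 1)(L − 1), with equality iff at most one vertex has degree ≥ 3, while
-- L − 1 ≥ Δ − 1, with equality iff no vertex other than one of degree Δ has degree ≥ 3.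

module Submission where

open import Data.Nat using (ℕ; zero; suc; _+_; _*_; _∸_; _≤_; _<_; z≤n; s≤s; _<ᵇ_; _≤?_)
import Data.Nat as ℕ
open import Data.Nat.Properties hiding (_≟_)
open import Data.Nat.Tactic.RingSolver using (solve-∀)
import Data.Nat.ListAction as List
open import Data.Nat.ListAction.Properties using (sum-++)
open import Data.Bool using (Bool; true; false; _∨_; _∧_; if_then_else_)
open import Data.Bool.Properties using (∨-zeroʳ; T-≡; ⇔→≡) renaming (_≟_ to _≟ᵇ_)
open import Data.Bool.ListAction using (any)
open import Data.Fin using (Fin; toℕ; fromℕ<; punchIn; punchOut; inject₁; fromℕ) renaming (zero to fzero; suc to fsuc)
open import Data.Fin.Properties
  using (_≟_; any?; pigeonhole; toℕ-fromℕ<; toℕ-injective; toℕ<n; toℕ-inject₁; toℕ-fromℕ;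
         punchInᵢ≢i; punchIn-punchOut; punchIn-injective)
open import Data.List using (List; []; _∷_; map; allFin; tabulate; concatMap)
open import Data.List.Properties using (map-tabulate)
open import Data.List.Relation.Unary.Any using (satisfied)
open import Data.List.Relation.Unary.Any.Properties using (any⁺; any⁻)
open import Data.List.Membership.Propositional using (lose)
open import Data.List.Membership.Propositional.Properties using (∈-allFin)
open import Algebra.Properties.CommutativeMonoid.Sum +-0-commutativeMonoid
  using (sum; sum-remove; sum-init-last; ∑-distrib-+; ∑-comm; sum-cong-≗; sum-replicate-zero)
open import Algebra.Properties.Semiring.Sum +-*-semiring using (*-distribˡ-sum)
open import Data.Product using (∃; _×_; _,_; proj₁; proj₂)
open import Data.Sum using (_⊎_; inj₁; inj₂; [_,_])
open import Data.Empty using (⊥; ⊥-elim)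
open import Function using (_∘_; id)
open import Function.Bundles using (_⇔_; mk⇔; Equivalence)
open import Relation.Binary using (tri<; tri≈; tri>)
open import Relation.Binary.PropositionalEquality hiding ([_])
open import Relation.Nullary using (¬_; Dec; does; yes; no; contradiction)
open import Relation.Nullary.Decidable using (_×-dec_; ¬?; dec-true; dec-false)
open import Relation.Nullary.Reflects using (ofʸ; ofⁿ)
open import Defs hiding (sym)

-- Sums over Fin n

sum-tabulate : ∀ {n} (f : Fin n → ℕ) → List.sum (tabulate f) ≡ sum f
sum-tabulate {zero}  f = refl
sum-tabulate {suc n} f = cong (f fzero +_) (sum-tabulate (f ∘ fsuc))

sum-allFin : ∀ {n} (f : Fin n → ℕ) → List.sum (map f (allFin n)) ≡ sum f
sum-allFin {n} f = trans (cong List.sum (map-tabulate id f)) (sum-tabulate f)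

sum-concatMap : ∀ {A : Set} (f : A → List ℕ) (xs : List A) →
                List.sum (concatMap f xs) ≡ List.sum (map (List.sum ∘ f) xs)
sum-concatMap f []       = refl
sum-concatMap f (x ∷ xs) = trans (sum-++ (f x) (concatMap f xs)) (cong (List.sum (f x) +_) (sum-concatMap f xs))

any-allFin⁺ : ∀ {n} (p : Fin n → Bool) x → p x ≡ true → any p (allFin n) ≡ true
any-allFin⁺ p x px = Equivalence.to T-≡ (any⁺ p (lose (∈-allFin x) (Equivalence.from T-≡ px)))

any-allFin⁻ : ∀ {n} (p : Fin n → Bool) → any p (allFin n) ≡ true → ∃ λ x → p x ≡ true
any-allFin⁻ {n} p e with satisfied (any⁻ p (allFin n) (Equivalence.from T-≡ e))
... | x , px = x , Equivalence.to T-≡ px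

term≤sum : ∀ {n} (f : Fin n → ℕ) a → f a ≤ sum f
term≤sum {suc n} f a = subst (f a ≤_) (sym (sum-remove {i = a} f)) (m≤m+n (f a) _)

positive-term : ∀ {n} (f : Fin n → ℕ) → 0 < sum f → ∃ λ x → 0 < f x
positive-term {suc n} f h with f fzero in eq
... | suc _ = fzero , subst (0 <_) (sym eq) (s≤s z≤n)
... | zero with positive-term (f ∘ fsuc) h
...   | x , p = fsuc x , p

sum-agree-except : ∀ {n} (a : Fin n) (f g : Fin n → ℕ) → (∀ x → x ≢ a → f x ≡ g x) →
                   sum f + g a ≡ sum g + f a
sum-agree-except {suc n} a f g agree = begin
  sum f + g a                                 ≡⟨ cong (_+ g a) (sum-remove {i = a} f) ⟩
  f a + sum (f ∘ punchIn a) + g a             ≡⟨ cong (λ s → f a + s + g a) (sum-cong-≗ (λ x → agree (punchIn a x) (punchInᵢ≢i a x))) ⟩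
  f a + sum (g ∘ punchIn a) + g a             ≡⟨ swap (f a) _ (g a) ⟩
  g a + sum (g ∘ punchIn a) + f a             ≡⟨ cong (_+ f a) (sym (sum-remove {i = a} g)) ⟩
  sum g + f a                                 ∎
  where
  open ≡-Reasoning
  swap : ∀ x y z → x + y + z ≡ z + y + x
  swap = solve-∀

suc[∸2]≡∸1 : ∀ {m} → 2 ≤ m → suc (m ∸ 2) ≡ m ∸ 1
suc[∸2]≡∸1 (s≤s (s≤s _)) = refl

+-≤-tight : ∀ {a b c d} → a ≤ b → c ≤ d → b + d ≡ a + c → b ≡ a × d ≡ c
+-≤-tight {a} {b} {c} {d} a≤b c≤d e with m≤n⇒m<n∨m≡n a≤b
... | inj₂ refl = refl , +-cancelˡ-≡ a d c e
... | inj₁ a<b  = ⊥-elim (<-irrefl (sym e) (+-mono-<-≤ a<b c≤d))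

indicator : ∀ {n} → Fin n → Fin n → ℕ
indicator a x = if does (x ≟ a) then 1 else 0

indicator-self : ∀ {n} (a : Fin n) → indicator a a ≡ 1
indicator-self a = cong (λ b → if b then 1 else 0) (dec-true (a ≟ a) refl)

indicator-other : ∀ {n} {a x : Fin n} → x ≢ a → indicator a x ≡ 0
indicator-other {a = a} {x} x≢a = cong (λ b → if b then 1 else 0) (dec-false (x ≟ a) x≢a)

sum-indicator-* : ∀ {n} (a : Fin n) (h : Fin n → ℕ) → sum (λ x → indicator a x * h x) ≡ h a
sum-indicator-* {suc n} a h = begin
  sum (λ x → indicator a x * h x)
    ≡⟨ sum-remove {i = a} (λ x → indicator a x * h x) ⟩
  indicator a a * h a + sum (λ x → indicator a (punchIn a x) * h (punchIn a x))
    ≡⟨ cong₂ _+_ (cong (_* h a) (indicator-self a))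
                 (sum-cong-≗ (λ x → cong (_* h (punchIn a x)) (indicator-other (punchInᵢ≢i a x)))) ⟩
  h a + 0 + sum {n} (λ _ → 0)
    ≡⟨ cong₂ _+_ (+-identityʳ (h a)) (sum-replicate-zero n) ⟩
  h a + 0
    ≡⟨ +-identityʳ (h a) ⟩
  h a ∎
  where open ≡-Reasoning

sum-indicator : ∀ {n} (a : Fin n) → sum (indicator a) ≡ 1
sum-indicator a = trans (sum-cong-≗ {x = indicator a} {y = λ x → indicator a x * 1} (λ x → sym (*-identityʳ (indicator a x))))
                        (sum-indicator-* a (λ _ → 1))

sum²-+indicator : ∀ {n} (Q : Fin n → ℕ) (a : Fin n) (D : Fin n → Fin n → ℕ) →
  (∀ x → D x x ≡ 0) → (∀ x y → D x y ≡ D y x) →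
  sum (λ x → sum (λ y → (Q x + indicator a x) * (Q y + indicator a y) * D x y)) ≡
  sum (λ x → sum (λ y → Q x * Q y * D x y)) + 2 * sum (λ y → Q y * D a y)
sum²-+indicator {n} Q a D hollow symmetric = begin
  sum (λ x → sum (λ y → (Q x + indicator a x) * (Q y + indicator a y) * D x y))
    ≡⟨ sum-cong-≗ (λ x → sum-cong-≗ (λ y → expand (Q x) (indicator a x) (Q y) (indicator a y) (D x y))) ⟩
  sum (λ x → sum (λ y → Q x * Q y * D x y + (Q x * (indicator a y * D x y) + indicator a x * ((Q y + indicator a y) * D x y))))
    ≡⟨ sum-cong-≗ (λ x → inner x) ⟩
  sum (λ x → sum (λ y → Q x * Q y * D x y) + (Q x * D x a + indicator a x * sum (λ y → (Q y + indicator a y) * D x y)))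
    ≡⟨ trans (∑-distrib-+ (λ x → sum (λ y → Q x * Q y * D x y)) _) (cong (C +_) (∑-distrib-+ (λ x → Q x * D x a) _)) ⟩
  C + (sum (λ x → Q x * D x a) + sum (λ x → indicator a x * sum (λ y → (Q y + indicator a y) * D x y)))
    ≡⟨ cong (C +_) (cong₂ _+_ (sum-cong-≗ (λ x → cong (Q x *_) (symmetric x a)))
                              (sum-indicator-* a (λ x → sum (λ y → (Q y + indicator a y) * D x y)))) ⟩
  C + (B + sum (λ y → (Q y + indicator a y) * D a y))
    ≡⟨ cong (λ z → C + (B + z)) row-a ⟩
  C + (B + (B + 0))
    ∎
  where
  open ≡-Reasoning
  C : ℕ
  C = sum (λ x → sum (λ y → Q x * Q y * D x y))
  B : ℕ
  B = sum (λ y → Q y * D a y)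
  expand : ∀ q e r f d → (q + e) * (r + f) * d ≡ q * r * d + (q * (f * d) + e * ((r + f) * d))
  expand = solve-∀
  inner : ∀ x → sum (λ y → Q x * Q y * D x y + (Q x * (indicator a y * D x y) + indicator a x * ((Q y + indicator a y) * D x y)))
              ≡ sum (λ y → Q x * Q y * D x y) + (Q x * D x a + indicator a x * sum (λ y → (Q y + indicator a y) * D x y))
  inner x = trans (∑-distrib-+ (λ y → Q x * Q y * D x y) _) (cong (sum (λ y → Q x * Q y * D x y) +_)
    (trans (∑-distrib-+ (λ y → Q x * (indicator a y * D x y)) _)
           (cong₂ _+_ (trans (sym (*-distribˡ-sum (Q x) (λ y → indicator a y * D x y))) (cong (Q x *_) (sum-indicator-* a (D x))))
                      (sym (*-distribˡ-sum (indicator a x) (λ y → (Q y + indicator a y) * D x y))))))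
  row-a : sum (λ y → (Q y + indicator a y) * D a y) ≡ B + 0
  row-a = begin
    sum (λ y → (Q y + indicator a y) * D a y)           ≡⟨ sum-cong-≗ (λ y → *-distribʳ-+ (D a y) (Q y) (indicator a y)) ⟩
    sum (λ y → Q y * D a y + indicator a y * D a y)     ≡⟨ ∑-distrib-+ (λ y → Q y * D a y) _ ⟩
    B + sum (λ y → indicator a y * D a y)               ≡⟨ cong (B +_) (trans (sum-indicator-* a (D a)) (hollow a)) ⟩
    B + 0                                               ∎

-- Walks and distances

unreached : Bool → ℕ
unreached b = if b then 0 else 1

module _ {n : ℕ} (G : Graph n) where

  data Reach : ℕ → Fin n → Fin n → Set where
    reach-refl : ∀ {k u} → Reach k u u
    reach-snoc : ∀ {k u w v} → Reach k u w → adj G w v ≡ true → Reach (suc k) u v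

  reach-mono : ∀ {j k u v} → j ≤ k → Reach j u v → Reach k u v
  reach-mono _       reach-refl       = reach-refl
  reach-mono (s≤s le) (reach-snoc r e) = reach-snoc (reach-mono le r) e

  reach-weaken : ∀ {k u v} → Reach k u v → Reach (suc k) u v
  reach-weaken = reach-mono (n≤1+n _)

  reach-cons : ∀ {k u w v} → adj G u w ≡ true → Reach k w v → Reach (suc k) u v
  reach-cons e reach-refl        = reach-snoc reach-refl e
  reach-cons e (reach-snoc r e′) = reach-snoc (reach-cons e r) e′

  reach-sym : ∀ {k u v} → Reach k u v → Reach k v u
  reach-sym reach-refl                         = reach-refl
  reach-sym (reach-snoc {w = w} {v = v} r e) = reach-cons (trans (Graph.sym G v w) e) (reach-sym r)

  walk→reach : ∀ {u v} → Walk G u v → ∃ λ k → Reach k u v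
  walk→reach here = 0 , reach-refl
  walk→reach (step e w) with walk→reach w
  ... | k , r = suc k , reach-cons e r

  reach→walk : ∀ {k u v} → Reach k u v → Walk G u v
  reach→walk reach-refl       = here
  reach→walk (reach-snoc r e) = snoc (reach→walk r) e
    where
    snoc : ∀ {u w v} → Walk G u w → adj G w v ≡ true → Walk G u v
    snoc here         e = step e here
    snoc (step e′ w) e = step e′ (snoc w e)

  within-refl : ∀ k u → within G k u u ≡ true
  within-refl zero    u = dec-true (u ≟ u) refl
  within-refl (suc k) u = cong (_∨ any (λ w → within G k u w ∧ adj G w u) (allFin n)) (within-refl k u)

  within-sound : ∀ k u v → within G k u v ≡ true → Reach k u v
  within-sound zero    u v e with u ≟ v
  ... | yes refl = reach-refl
  within-sound (suc k) u v e with within G k u v in eq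
  ... | true = reach-weaken (within-sound k u v eq)
  ... | false with any-allFin⁻ _ e
  ...   | w , q with within G k u w in eq′
  ...     | true = reach-snoc (within-sound k u w eq′) q

  within-complete : ∀ {k u v} → Reach k u v → within G k u v ≡ true
  within-complete {k} {u} reach-refl = within-refl k u
  within-complete {suc k} {u} {v} (reach-snoc {w = w} r e) =
    trans (cong (within G k u v ∨_) (any-allFin⁺ _ w (trans (cong (_∧ adj G w v) (within-complete r)) e)))
          (∨-zeroʳ _)

  within-sym : ∀ k u v → within G k u v ≡ within G k v u
  within-sym k u v = ⇔→≡ (mk⇔ (within-complete ∘ reach-sym ∘ within-sound k u v)
                               (within-complete ∘ reach-sym ∘ within-sound k v u))

  unreachedAt : ℕ → Fin n → Fin n → ℕ
  unreachedAt k u v = unreached (within G k u v)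

  dist-sum : ∀ u v → dist G u v ≡ sum (λ (k : Fin n) → unreachedAt (toℕ k) u v)
  dist-sum u v = sum-allFin (λ (k : Fin n) → unreachedAt (toℕ k) u v)

  dist-cong : ∀ {u v x y} → (∀ k → within G k u v ≡ within G k x y) → dist G u v ≡ dist G x y
  dist-cong {u} {v} {x} {y} eq = begin
    dist G u v                                         ≡⟨ dist-sum u v ⟩
    sum (λ (k : Fin n) → unreachedAt (toℕ k) u v)      ≡⟨ sum-cong-≗ {n} (λ k → cong unreached (eq (toℕ k))) ⟩
    sum (λ (k : Fin n) → unreachedAt (toℕ k) x y)      ≡⟨ dist-sum x y ⟨
    dist G x y                                         ∎
    where open ≡-Reasoning

  dist-sym : ∀ u v → dist G u v ≡ dist G v u
  dist-sym u v = dist-cong (λ k → within-sym k u v)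

  dist-self : ∀ u → dist G u u ≡ 0
  dist-self u = begin
    dist G u u                                         ≡⟨ dist-sum u u ⟩
    sum (λ (k : Fin n) → unreachedAt (toℕ k) u u)      ≡⟨ sum-cong-≗ {n} (λ k → cong unreached (within-refl (toℕ k) u)) ⟩
    sum {n} (λ _ → 0)                                  ≡⟨ sum-replicate-zero n ⟩
    0                                                  ∎
    where open ≡-Reasoning

dist≡0⇒≡ : ∀ {m} (G : Graph (suc m)) u v → dist G u v ≡ 0 → u ≡ v
dist≡0⇒≡ G u v e = reach-zero (within-sound G 0 u v (unreached≡0 (within G 0 u v) head≡0))
  where
  head≡0 : unreached (within G 0 u v) ≡ 0
  head≡0 = m+n≡0⇒m≡0 _ (trans (sym (dist-sum G u v)) e)
  unreached≡0 : ∀ b → unreached b ≡ 0 → b ≡ true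
  unreached≡0 true _ = refl
  reach-zero : ∀ {x y} → Reach G 0 x y → x ≡ y
  reach-zero reach-refl = refl

-- Pendant vertices and their removal

count : Bool → ℕ
count b = if b then 1 else 0

count≤1 : ∀ b → count b ≤ 1
count≤1 true  = ≤-refl
count≤1 false = z≤n

0<count⇒true : ∀ {b} → 0 < count b → b ≡ true
0<count⇒true {true} _ = refl

module _ {n : ℕ} (G : Graph n) where

  deg-sum : ∀ v → deg G v ≡ sum (λ w → count (adj G v w))
  deg-sum v = sum-allFin (λ w → count (adj G v w))

  adj-irrefl : ∀ {u} → adj G u u ≡ true → ⊥
  adj-irrefl {u} e with trans (sym e) (Graph.irref G u)
  ... | ()

  0<deg⇒neighbour : ∀ v → 0 < deg G v → ∃ λ w → adj G v w ≡ true
  0<deg⇒neighbour v h with positive-term (λ w → count (adj G v w)) (subst (0 <_) (deg-sum v) h)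
  ... | w , c>0 = w , 0<count⇒true c>0

  neighbour⇒0<deg : ∀ {v w} → adj G v w ≡ true → 0 < deg G v
  neighbour⇒0<deg {v} {w} e = subst (0 <_) (sym (deg-sum v))
    (≤-trans (≤-reflexive (cong count (sym e))) (term≤sum (λ x → count (adj G v x)) w))

module _ {m : ℕ} (G : Graph (suc m)) where

  deg-remove : ∀ v a → deg G v ≡ count (adj G v a) + sum (λ y → count (adj G v (punchIn a y)))
  deg-remove v a = trans (deg-sum G v) (sum-remove {i = a} (λ w → count (adj G v w)))

  2≤deg⇒other-neighbour : ∀ v → 2 ≤ deg G v → ∀ a → ∃ λ b → b ≢ a × adj G v b ≡ true
  2≤deg⇒other-neighbour v h a with positive-term (λ y → count (adj G v (punchIn a y))) others>0
    where
    others>0 : 0 < sum (λ y → count (adj G v (punchIn a y)))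
    others>0 = ≤-pred (≤-trans (subst (2 ≤_) (deg-remove v a) h) (+-monoˡ-≤ _ (count≤1 (adj G v a))))
  ... | y , c>0 = punchIn a y , punchInᵢ≢i a y , 0<count⇒true c>0

  distinct-neighbours⇒2≤deg : ∀ {v a b} → a ≢ b → adj G v a ≡ true → adj G v b ≡ true → 2 ≤ deg G v
  distinct-neighbours⇒2≤deg {v} {a} {b} a≢b ea eb = subst (2 ≤_) (sym (deg-remove v a))
    (+-mono-≤ (≤-reflexive (cong count (sym ea)))
              (≤-trans (≤-reflexive (cong count (sym eb′))) (term≤sum (λ y → count (adj G v (punchIn a y))) (punchOut a≢b))))
    where
    eb′ : adj G v (punchIn a (punchOut a≢b)) ≡ true
    eb′ = subst (λ x → adj G v x ≡ true) (sym (punchIn-punchOut a≢b)) eb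

  record PendantAt (ℓ : Fin (suc m)) : Set where
    field
      parent   : Fin m
      adjacent : adj G ℓ (punchIn ℓ parent) ≡ true
      unique   : ∀ w → adj G ℓ w ≡ true → w ≡ punchIn ℓ parent

  -- Only the properties of the chosen neighbour matter; abstract keeps it from unfolding in later goals.
  abstract
    deg≡1⇒PendantAt : ∀ ℓ → deg G ℓ ≡ 1 → PendantAt ℓ
    deg≡1⇒PendantAt ℓ d≡1 with 0<deg⇒neighbour G ℓ (≤-reflexive (sym d≡1))
    ... | b , eb = record
      { parent   = punchOut ℓ≢b
      ; adjacent = subst (λ x → adj G ℓ x ≡ true) (sym (punchIn-punchOut ℓ≢b)) eb
      ; unique   = λ w ew → trans (only-b w ew) (sym (punchIn-punchOut ℓ≢b))
      }
      where
      ℓ≢b : ℓ ≢ b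
      ℓ≢b refl = adj-irrefl G eb
      only-b : ∀ w → adj G ℓ w ≡ true → w ≡ b
      only-b w ew with w ≟ b
      ... | yes w≡b = w≡b
      ... | no  w≢b = ⊥-elim (<-irrefl refl (subst (2 ≤_) d≡1 (distinct-neighbours⇒2≤deg w≢b ew eb)))

removeVertex : ∀ {m} → Graph (suc m) → Fin (suc m) → Graph m
removeVertex G ℓ = record
  { adj   = λ x y → adj G (punchIn ℓ x) (punchIn ℓ y)
  ; sym   = λ x y → Graph.sym G (punchIn ℓ x) (punchIn ℓ y)
  ; irref = λ x → Graph.irref G (punchIn ℓ x)
  }

punchIn-or-self : ∀ {m} (ℓ u : Fin (suc m)) → u ≡ ℓ ⊎ ∃ λ x → u ≡ punchIn ℓ x
punchIn-or-self ℓ u with u ≟ ℓ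
... | yes u≡ℓ = inj₁ u≡ℓ
... | no  u≢ℓ = inj₂ (punchOut (u≢ℓ ∘ sym) , sym (punchIn-punchOut (u≢ℓ ∘ sym)))

-- Walks of length below the order suffice; only then does dist, which inspects radii
-- below the order, compute the graph distance.
SmallDiameter : ∀ {n} → Graph n → Set
SmallDiameter {n} G = ∀ u v → Reach G (n ∸ 1) u v

module LeafRemoval {m : ℕ} (T : Graph (suc m)) (ℓ : Fin (suc m)) (pendant : PendantAt T ℓ) where
  open PendantAt pendant public

  T′ : Graph m
  T′ = removeVertex T ℓ

  ι : Fin m → Fin (suc m)
  ι = punchIn ℓ

  p : Fin (suc m)
  p = ι parent

  adj-ℓ : ∀ u → adj T u ℓ ≡ true → u ≡ p
  adj-ℓ u e = unique u (trans (Graph.sym T ℓ u) e)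

  reach-lift : ∀ {k x y} → Reach T′ k x y → Reach T k (ι x) (ι y)
  reach-lift reach-refl       = reach-refl
  reach-lift (reach-snoc r e) = reach-snoc (reach-lift r) e

  -- A walk between vertices other than ℓ can only pass through ℓ as p ℓ p, which is cut out.
  reach-lower : ∀ {k u v} x y → u ≡ ι x → v ≡ ι y → Reach T k u v → Reach T′ k x y
  reach-lower x y refl v≡ reach-refl = subst (Reach T′ _ x) (punchIn-injective ℓ x y v≡) reach-refl
  reach-lower x y u≡ v≡ (reach-snoc {w = w} {v = v} r e) with punchIn-or-self ℓ w
  ... | inj₂ (z , refl) = reach-snoc (reach-lower x z u≡ refl r) (subst (λ v → adj T (ι z) v ≡ true) v≡ e)
  ... | inj₁ refl with r
  ...   | reach-refl = ⊥-elim (punchInᵢ≢i ℓ x (sym u≡))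
  ...   | reach-snoc {w = w′} r′ e′ =
    subst (Reach T′ _ x) (punchIn-injective ℓ parent y (trans (sym (unique v e)) v≡))
          (reach-weaken T′ (reach-weaken T′ (reach-lower x parent u≡ (adj-ℓ w′ e′) r′)))

  reach-ℓ : ∀ {k} y → Reach T (suc k) (ι y) ℓ ⇔ Reach T′ k y parent
  reach-ℓ y = mk⇔ (to refl) (λ r → reach-snoc (reach-lift r) (trans (Graph.sym T p ℓ) adjacent))
    where
    to : ∀ {k u} → u ≡ ι y → Reach T (suc k) u ℓ → Reach T′ k y parent
    to u≡ reach-refl = ⊥-elim (punchInᵢ≢i ℓ y (sym u≡))
    to u≡ (reach-snoc {w = w} r e) = reach-lower y parent u≡ (adj-ℓ w e) r

  within-ι : ∀ k x y → within T k (ι x) (ι y) ≡ within T′ k x y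
  within-ι k x y = ⇔→≡ (mk⇔ (within-complete T′ ∘ reach-lower x y refl refl ∘ within-sound T k (ι x) (ι y))
                            (within-complete T ∘ reach-lift ∘ within-sound T′ k x y))

  within-ℓ : ∀ k y → within T (suc k) (ι y) ℓ ≡ within T′ k y parent
  within-ℓ k y = ⇔→≡ (mk⇔ (within-complete T′ ∘ Equivalence.to (reach-ℓ y) ∘ within-sound T (suc k) (ι y) ℓ)
                          (within-complete T ∘ Equivalence.from (reach-ℓ y) ∘ within-sound T′ k y parent))

  dist-ℓ : ∀ y → dist T (ι y) ℓ ≡ suc (dist T′ y parent)
  dist-ℓ y = begin
    dist T (ι y) ℓ
      ≡⟨ dist-sum T (ι y) ℓ ⟩
    unreached (within T 0 (ι y) ℓ) + sum (λ (k : Fin m) → unreachedAt T (suc (toℕ k)) (ι y) ℓ)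
      ≡⟨ cong₂ _+_ (cong unreached (dec-false (ι y ≟ ℓ) (punchInᵢ≢i ℓ y)))
                   (sum-cong-≗ {m} (λ k → cong unreached (within-ℓ (toℕ k) y))) ⟩
    suc (sum (λ (k : Fin m) → unreachedAt T′ (toℕ k) y parent))
      ≡⟨ cong suc (dist-sum T′ y parent) ⟨
    suc (dist T′ y parent) ∎
    where open ≡-Reasoning

  dist-ι : SmallDiameter T′ → ∀ x y → dist T (ι x) (ι y) ≡ dist T′ x y
  dist-ι diam x y = begin
    dist T (ι x) (ι y)
      ≡⟨ dist-sum T (ι x) (ι y) ⟩
    sum (λ (k : Fin (suc m)) → unreachedAt T (toℕ k) (ι x) (ι y))
      ≡⟨ sum-init-last {m} (λ k → unreachedAt T (toℕ k) (ι x) (ι y)) ⟩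
    sum (λ (k : Fin m) → unreachedAt T (toℕ (inject₁ k)) (ι x) (ι y)) + unreachedAt T (toℕ (fromℕ m)) (ι x) (ι y)
      ≡⟨ cong₂ _+_ (sum-cong-≗ {m} (λ k → cong (λ r → unreachedAt T r (ι x) (ι y)) (toℕ-inject₁ k)))
                   (cong (λ r → unreachedAt T r (ι x) (ι y)) (toℕ-fromℕ m)) ⟩
    sum (λ (k : Fin m) → unreachedAt T (toℕ k) (ι x) (ι y)) + unreachedAt T m (ι x) (ι y)
      ≡⟨ cong₂ _+_ (sum-cong-≗ {m} (λ k → cong unreached (within-ι (toℕ k) x y)))
                   (cong unreached (within-complete T (reach-lift (reach-mono T′ (m∸n≤m m 1) (diam x y))))) ⟩
    sum (λ (k : Fin m) → unreachedAt T′ (toℕ k) x y) + 0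
      ≡⟨ +-identityʳ _ ⟩
    sum (λ (k : Fin m) → unreachedAt T′ (toℕ k) x y)
      ≡⟨ dist-sum T′ x y ⟨
    dist T′ x y ∎
    where open ≡-Reasoning

  isTree : IsTree T → IsTree T′
  isTree (connected , acyclic) = connected′ , acyclic′
    where
    connected′ : Connected T′
    connected′ x y with walk→reach T (connected (ι x) (ι y))
    ... | _ , r = reach→walk T′ (reach-lower x y refl refl r)
    acyclic′ : Acyclic T′
    acyclic′ C = acyclic record
      { m     = Cycle.m C
      ; vert  = ι ∘ Cycle.vert C
      ; inj   = Cycle.inj C ∘ punchIn-injective ℓ _ _
      ; edges = Cycle.edges C
      ; close = Cycle.close C
      }

  reach-ℓ-within-order : SmallDiameter T′ → ∀ y → Reach T m (ι y) ℓ
  reach-ℓ-within-order diam y =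
    subst (λ k → Reach T k (ι y) ℓ) (suc-pred-order parent) (Equivalence.from (reach-ℓ y) (diam y parent))
    where
    suc-pred-order : ∀ {n} → Fin n → suc (n ∸ 1) ≡ n
    suc-pred-order {suc n} _ = refl

  smallDiameter : SmallDiameter T′ → SmallDiameter T
  smallDiameter diam u v with punchIn-or-self ℓ u | punchIn-or-self ℓ v
  ... | inj₁ refl       | inj₁ refl       = reach-refl
  ... | inj₁ refl       | inj₂ (y , refl) = reach-sym T (reach-ℓ-within-order diam y)
  ... | inj₂ (x , refl) | inj₁ refl       = reach-ℓ-within-order diam x
  ... | inj₂ (x , refl) | inj₂ (y , refl) = reach-lift (reach-mono T′ (m∸n≤m m 1) (diam x y))

  deg-ι : ∀ x → deg T (ι x) ≡ count (adj T (ι x) ℓ) + deg T′ x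
  deg-ι x = trans (deg-remove T (ι x) ℓ) (cong (count (adj T (ι x) ℓ) +_) (sym (deg-sum T′ x)))

  deg-parent : deg T p ≡ suc (deg T′ parent)
  deg-parent = trans (deg-ι parent) (cong (λ b → count b + deg T′ parent) (trans (Graph.sym T p ℓ) adjacent))

  deg-other : ∀ x → x ≢ parent → deg T (ι x) ≡ deg T′ x
  deg-other x x≢parent with adj T (ι x) ℓ in e
  ... | true  = ⊥-elim (x≢parent (punchIn-injective ℓ x parent (adj-ℓ (ι x) e)))
  ... | false = trans (deg-ι x) (cong (λ b → count b + deg T′ x) e)

-- Leaves and diameter of trees

module _ {n : ℕ} (G : Graph n) where

  closed-walk⇒cycle : (y : ℕ → Fin n) (d : ℕ) → y (suc d) ≡ y 0 →
    (∀ t → t ≤ d → adj G (y t) (y (suc t)) ≡ true) →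
    (∀ t → suc t ≤ d → y (suc (suc t)) ≢ y t) →
    (∀ a b → a ≤ d → b ≤ d → y a ≡ y b → a ≡ b) →
    Cycle G
  closed-walk⇒cycle y zero closes edge _ _ =
    ⊥-elim (adj-irrefl G (subst (λ v → adj G (y 0) v ≡ true) closes (edge 0 z≤n)))
  closed-walk⇒cycle y (suc zero) closes _ non-backtracking _ =
    ⊥-elim (non-backtracking 0 ≤-refl closes)
  closed-walk⇒cycle y (suc (suc d)) closes edge _ distinct = record
    { m     = d
    ; vert  = y ∘ toℕ
    ; inj   = λ {a} {b} e → toℕ-injective (distinct (toℕ a) (toℕ b) (≤-pred (toℕ<n a)) (≤-pred (toℕ<n b)) e)
    ; edges = λ t → subst (λ k → adj G (y k) (y (suc (toℕ t))) ≡ true) (sym (toℕ-inject₁ t))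
                          (edge (toℕ t) (≤-trans (≤-pred (toℕ<n t)) (n≤1+n _)))
    ; close = subst (λ k → adj G (y k) (y 0) ≡ true) (sym (toℕ-fromℕ (suc (suc d))))
                    (subst (λ v → adj G (y (suc (suc d))) v ≡ true) closes (edge (suc (suc d)) ≤-refl))
    }

minimal-witness : ∀ {P : ℕ → Set} → (∀ k → Dec (P k)) → ∀ {N} → P N →
                  ∃ λ j → P j × (∀ {k} → k < j → ¬ P k)
minimal-witness {P} P? {N} pN with none-below-or-minimal (suc N)
  where
  none-below-or-minimal : ∀ N → (∀ {k} → k < N → ¬ P k) ⊎ (∃ λ j → P j × (∀ {k} → k < j → ¬ P k))
  none-below-or-minimal zero = inj₁ (λ ())
  none-below-or-minimal (suc N) with none-below-or-minimal N
  ... | inj₂ minimal = inj₂ minimal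
  ... | inj₁ none with P? N
  ...   | yes pN = inj₂ (N , pN , none)
  ...   | no ¬pN = inj₁ (λ k<1+N → [ none , (λ { refl → ¬pN }) ] (m<1+n⇒m<n∨m≡n k<1+N))
... | inj₁ none    = ⊥-elim (none (n<1+n N) pN)
... | inj₂ minimal = minimal

private
  module NonBacktrackingWalk {m : ℕ} (G : Graph (suc m)) (c : Fin (suc m)) (c-adj : ∃ λ w → adj G c w ≡ true)
                             (branching : ∀ w → w ≢ c → 2 ≤ deg G w) where

    next : Fin (suc m) → Fin (suc m) → Fin (suc m)
    next prev cur with any? (λ w → (adj G cur w ≟ᵇ true) ×-dec ¬? (w ≟ prev))
    ... | yes (w , _) = w
    ... | no  _       = prev

    next-spec : ∀ prev cur → (∃ λ w → adj G cur w ≡ true × w ≢ prev) →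
                adj G cur (next prev cur) ≡ true × next prev cur ≢ prev
    next-spec prev cur ex with any? (λ w → (adj G cur w ≟ᵇ true) ×-dec ¬? (w ≟ prev))
    ... | yes (w , spec) = spec
    ... | no  ∄w         = ⊥-elim (∄w ex)

    trail : ℕ → Fin (suc m) × Fin (suc m)
    trail zero    = c , c
    trail (suc t) = proj₂ (trail t) , next (proj₁ (trail t)) (proj₂ (trail t))

    x : ℕ → Fin (suc m)
    x = proj₂ ∘ trail

    trail-step : ∀ t → t ≡ 0 ⊎ x t ≢ c → adj G (x t) (x (suc t)) ≡ true × x (suc t) ≢ proj₁ (trail t)
    trail-step t h = next-spec (proj₁ (trail t)) (x t) (exit t h)
      where
      exit : ∀ t → t ≡ 0 ⊎ x t ≢ c → ∃ λ w → adj G (x t) w ≡ true × w ≢ proj₁ (trail t)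
      exit .zero (inj₁ refl) = proj₁ c-adj , proj₂ c-adj , λ { refl → adj-irrefl G (proj₂ c-adj) }
      exit t (inj₂ xt≢c) with 2≤deg⇒other-neighbour G (x t) (branching (x t) xt≢c) (proj₁ (trail t))
      ... | w , w≢prev , e = w , e , w≢prev

    Revisits : ℕ → Set
    Revisits j = ∃ λ (i : Fin j) → x (toℕ i) ≡ x j

    first-revisit : ∃ λ j → Revisits j × (∀ {k} → k < j → ¬ Revisits k)
    first-revisit with pigeonhole (n<1+n (suc m)) (λ (t : Fin (suc (suc m))) → x (toℕ t))
    ... | a , b , a<b , xa≡xb =
      minimal-witness (λ j → any? (λ i → x (toℕ i) ≟ x j))
        (fromℕ< a<b , trans (cong x (toℕ-fromℕ< a<b)) xa≡xb)

    cycle : Cycle G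
    cycle with first-revisit
    ... | j , (i , xi≡xj) , first = closed-walk⇒cycle G y d closes edge non-backtracking distinct
      where
      distinct-before : ∀ {a b} → a < j → b < j → x a ≡ x b → a ≡ b
      distinct-before {a} {b} a<j b<j e with <-cmp a b
      ... | tri< a<b _ _ = ⊥-elim (first b<j (fromℕ< a<b , trans (cong x (toℕ-fromℕ< a<b)) e))
      ... | tri≈ _ a≡b _ = a≡b
      ... | tri> _ _ b<a = ⊥-elim (first a<j (fromℕ< b<a , trans (cong x (toℕ-fromℕ< b<a)) (sym e)))

      step-before : ∀ t → t < j → adj G (x t) (x (suc t)) ≡ true × x (suc t) ≢ proj₁ (trail t)
      step-before zero    _     = trail-step zero (inj₁ refl)
      step-before (suc t) 1+t<j = trail-step (suc t) (inj₂ λ e → 1+n≢0 (distinct-before 1+t<j (≤-trans (s≤s z≤n) 1+t<j) e))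

      d : ℕ
      d = proj₁ (m≤n⇒∃[o]m+o≡n (toℕ<n i))

      j≡ : j ≡ toℕ i + suc d
      j≡ = trans (sym (proj₂ (m≤n⇒∃[o]m+o≡n (toℕ<n i)))) (sym (+-suc (toℕ i) d))

      y : ℕ → Fin (suc m)
      y t = x (toℕ i + t)

      in-range : ∀ {t} → t ≤ d → toℕ i + t < j
      in-range {t} t≤d = subst (toℕ i + t <_) (sym j≡) (+-monoʳ-< (toℕ i) (s≤s t≤d))

      closes : y (suc d) ≡ y 0
      closes = trans (cong x (sym j≡)) (trans (sym xi≡xj) (cong x (sym (+-identityʳ (toℕ i)))))

      edge : ∀ t → t ≤ d → adj G (y t) (y (suc t)) ≡ true
      edge t t≤d = subst (λ k → adj G (y t) (x k) ≡ true) (sym (+-suc (toℕ i) t)) (proj₁ (step-before _ (in-range t≤d)))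

      non-backtracking : ∀ t → suc t ≤ d → y (suc (suc t)) ≢ y t
      non-backtracking t 1+t≤d = subst (λ k → x k ≢ y t) (sym (trans (+-suc (toℕ i) (suc t)) (cong suc (+-suc (toℕ i) t))))
        (proj₂ (step-before (suc (toℕ i + t)) (subst (_< j) (+-suc (toℕ i) t) (in-range 1+t≤d))))

      distinct : ∀ a b → a ≤ d → b ≤ d → y a ≡ y b → a ≡ b
      distinct a b a≤d b≤d e = +-cancelˡ-≡ (toℕ i) a b (distinct-before (in-range a≤d) (in-range b≤d) e)

walk⇒0<deg : ∀ {n} (G : Graph n) {u v} → Walk G u v → u ≢ v → 0 < deg G u
walk⇒0<deg G here       u≢v = ⊥-elim (u≢v refl)
walk⇒0<deg G (step e _) _   = neighbour⇒0<deg G e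

connected⇒0<deg : ∀ {n} (G : Graph n) → Connected G → ∀ {a b : Fin n} → a ≢ b → ∀ u → 0 < deg G u
connected⇒0<deg G connected {a} {b} a≢b u with u ≟ a
... | yes refl = walk⇒0<deg G (connected u b) a≢b
... | no  u≢a  = walk⇒0<deg G (connected u a) u≢a

-- If every vertex other than c had degree at least 2, a non-backtracking walk from c would close a cycle.
abstract
  leaf-avoiding : ∀ {m} (T : Graph (suc m)) → IsTree T → ∀ c {v} → v ≢ c → ∃ λ ℓ → ℓ ≢ c × deg T ℓ ≡ 1
  leaf-avoiding T (connected , acyclic) c v≢c with any? (λ w → ¬? (w ≟ c) ×-dec (deg T w ℕ.≟ 1))
  ... | yes leaf = leaf
  ... | no  ∄leaf = ⊥-elim (acyclic (NonBacktrackingWalk.cycle T c c-adj branching))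
    where
    0<deg : ∀ u → 0 < deg T u
    0<deg = connected⇒0<deg T connected v≢c
    c-adj : ∃ λ w → adj T c w ≡ true
    c-adj = 0<deg⇒neighbour T c (0<deg c)
    branching : ∀ w → w ≢ c → 2 ≤ deg T w
    branching w w≢c = ≤∧≢⇒< (0<deg w) (λ 1≡deg → ∄leaf (w , w≢c , sym 1≡deg))

tree⇒smallDiameter : ∀ {n} (T : Graph n) → IsTree T → SmallDiameter T
tree⇒smallDiameter {suc zero}    T _    fzero fzero = reach-refl
tree⇒smallDiameter {suc (suc k)} T tree = smallDiameter (tree⇒smallDiameter T′ (isTree tree))
  where
  leaf : ∃ λ ℓ → ℓ ≢ fzero × deg T ℓ ≡ 1
  leaf = leaf-avoiding T tree fzero {fsuc fzero} (λ ())
  open LeafRemoval T (proj₁ leaf) (deg≡1⇒PendantAt T (proj₁ leaf) (proj₂ (proj₂ leaf)))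

-- Leaf statistics and their recurrences

leafIndicator : ℕ → ℕ
leafIndicator 1 = 1
leafIndicator _ = 0

module _ {n : ℕ} (G : Graph n) where

  isLeaf : Fin n → ℕ
  isLeaf u = count (isPendentᵇ G u)

  isLeaf≡leafIndicator : ∀ u → isLeaf u ≡ leafIndicator (deg G u)
  isLeaf≡leafIndicator u with deg G u
  ... | 0           = refl
  ... | 1           = refl
  ... | suc (suc _) = refl

  leafCount : ℕ
  leafCount = sum isLeaf

  leafDistanceSum : ℕ
  leafDistanceSum = sum λ u → sum λ v → isLeaf u * isLeaf v * dist G u v

  distanceToLeaves : Fin n → ℕ
  distanceToLeaves c = sum λ v → isLeaf v * dist G c v

  excessDegree : ℕ
  excessDegree = sum λ u → deg G u ∸ 2

  AtMostOneBranching : Set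
  AtMostOneBranching = ∀ u v → 3 ≤ deg G u → 3 ≤ deg G v → u ≡ v

  BranchingOnlyAt : Fin n → Set
  BranchingOnlyAt c = ∀ w → w ≢ c → deg G w ≤ 2

  branchingOnlyAt⇒atMostOneBranching : ∀ c → BranchingOnlyAt c → AtMostOneBranching
  branchingOnlyAt⇒atMostOneBranching c only u v 3≤u 3≤v = trans (is-c u 3≤u) (sym (is-c v 3≤v))
    where
    is-c : ∀ u → 3 ≤ deg G u → u ≡ c
    is-c u 3≤u with u ≟ c
    ... | yes u≡c = u≡c
    ... | no  u≢c = ⊥-elim (<-irrefl refl (≤-trans 3≤u (only u u≢c)))

  private
    TW-term : Fin n → Fin n → ℕ
    TW-term u v = if (toℕ u <ᵇ toℕ v) ∧ isPendentᵇ G u ∧ isPendentᵇ G v then dist G u v else 0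

    if-∧≡count-* : ∀ a b d → (if a ∧ b then d else 0) ≡ count a * count b * d
    if-∧≡count-* false _     _ = refl
    if-∧≡count-* true  false _ = refl
    if-∧≡count-* true  true  d = sym (+-identityʳ d)

    TW-term-symmetrised : ∀ u v → TW-term u v + TW-term v u ≡ isLeaf u * isLeaf v * dist G u v
    TW-term-symmetrised u v
      with toℕ u <ᵇ toℕ v | <ᵇ-reflects-< (toℕ u) (toℕ v) | toℕ v <ᵇ toℕ u | <ᵇ-reflects-< (toℕ v) (toℕ u)
    ... | true  | ofʸ u<v | true  | ofʸ v<u = ⊥-elim (<-asym u<v v<u)
    ... | true  | _       | false | _       = trans (+-identityʳ _) (if-∧≡count-* (isPendentᵇ G u) _ _)
    ... | false | _       | true  | _       = begin
      (if isPendentᵇ G v ∧ isPendentᵇ G u then dist G v u else 0)  ≡⟨ if-∧≡count-* (isPendentᵇ G v) _ _ ⟩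
      isLeaf v * isLeaf u * dist G v u                            ≡⟨ cong₂ _*_ (*-comm (isLeaf v) _) (dist-sym G v u) ⟩
      isLeaf u * isLeaf v * dist G u v                            ∎
      where open ≡-Reasoning
    ... | false | ofⁿ u≮v | false | ofⁿ v≮u
      rewrite toℕ-injective (≤-antisym (≮⇒≥ v≮u) (≮⇒≥ u≮v)) = sym (trans (cong (isLeaf v * isLeaf v *_) (dist-self G v)) (*-zeroʳ (isLeaf v * isLeaf v)))

  2*TW≡leafDistanceSum : 2 * TW G ≡ leafDistanceSum
  2*TW≡leafDistanceSum = begin
    2 * TW G                                                   ≡⟨ cong (TW G +_) (+-identityʳ (TW G)) ⟩
    TW G + TW G                                                ≡⟨ cong₂ _+_ TW≡ TW≡ ⟩
    sum (λ u → sum (TW-term u)) + sum (λ u → sum (TW-term u))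
      ≡⟨ cong (sum (λ u → sum (TW-term u)) +_) (∑-comm TW-term) ⟩
    sum (λ u → sum (TW-term u)) + sum (λ u → sum (λ v → TW-term v u))
      ≡⟨ ∑-distrib-+ (λ u → sum (TW-term u)) _ ⟨
    sum (λ u → sum (TW-term u) + sum (λ v → TW-term v u))
      ≡⟨ sum-cong-≗ (λ u → ∑-distrib-+ (TW-term u) _) ⟨
    sum (λ u → sum (λ v → TW-term u v + TW-term v u))
      ≡⟨ sum-cong-≗ (λ u → sum-cong-≗ (TW-term-symmetrised u)) ⟩
    leafDistanceSum                                            ∎
    where
    open ≡-Reasoning
    TW≡ : TW G ≡ sum (λ u → sum (TW-term u))
    TW≡ = begin
      TW G                                                        ≡⟨ sum-concatMap _ (allFin n) ⟩
      List.sum (map (λ u → List.sum (map (TW-term u) (allFin n))) (allFin n))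
                                                                  ≡⟨ sum-allFin (λ u → List.sum (map (TW-term u) (allFin n))) ⟩
      sum (λ u → List.sum (map (TW-term u) (allFin n)))       ≡⟨ sum-cong-≗ (λ u → sum-allFin (TW-term u)) ⟩
      sum (λ u → sum (TW-term u))                             ∎

module LeafStep {k : ℕ} (T : Graph (suc (suc (suc k)))) (tree : IsTree T)
                (ℓ : Fin (suc (suc (suc k)))) (deg-ℓ : deg T ℓ ≡ 1) where

  open LeafRemoval T ℓ (deg≡1⇒PendantAt T ℓ deg-ℓ) public

  tree′ : IsTree T′
  tree′ = isTree tree

  d′ : Fin (suc (suc k)) → Fin (suc (suc k)) → ℕ
  d′ = dist T′

  diam′ : SmallDiameter T′
  diam′ = tree⇒smallDiameter T′ tree′

  leaf : Fin (suc (suc k)) → ℕ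
  leaf x = isLeaf T (ι x)

  parentDistances : ℕ
  parentDistances = sum λ y → leaf y * d′ parent y

  innerDistances : ℕ
  innerDistances = sum λ x → sum λ y → leaf x * leaf y * d′ x y

  isLeaf-ℓ : isLeaf T ℓ ≡ 1
  isLeaf-ℓ = trans (isLeaf≡leafIndicator T ℓ) (cong leafIndicator deg-ℓ)

  leafCount-step : leafCount T ≡ suc (sum leaf)
  leafCount-step = trans (sum-remove {i = ℓ} (isLeaf T)) (cong (_+ sum leaf) isLeaf-ℓ)

  excessDegree-step : excessDegree T ≡ sum λ x → deg T (ι x) ∸ 2
  excessDegree-step = trans (sum-remove {i = ℓ} (λ u → deg T u ∸ 2)) (cong (λ d → d ∸ 2 + sum (λ x → deg T (ι x) ∸ 2)) deg-ℓ)

  distanceToLeaves-step : ∀ c → distanceToLeaves T (ι c) ≡ suc (d′ c parent) + sum (λ y → leaf y * d′ c y)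
  distanceToLeaves-step c = trans (sum-remove {i = ℓ} (λ v → isLeaf T v * dist T (ι c) v))
    (cong₂ _+_ (trans (cong₂ _*_ isLeaf-ℓ (dist-ℓ c)) (+-identityʳ _))
               (sum-cong-≗ (λ y → cong (leaf y *_) (dist-ι diam′ c y))))

  leafDistanceSum-step : leafDistanceSum T ≡ innerDistances + 2 * (sum leaf + parentDistances)
  leafDistanceSum-step = begin
    leafDistanceSum T
      ≡⟨ sum-remove {i = ℓ} (λ u → sum λ v → isLeaf T u * isLeaf T v * dist T u v) ⟩
    sum (λ v → isLeaf T ℓ * isLeaf T v * dist T ℓ v) + sum (λ x → sum λ v → leaf x * isLeaf T v * dist T (ι x) v)
      ≡⟨ cong₂ _+_ row-ℓ (trans (sum-cong-≗ row-ι) (∑-distrib-+ (λ x → leaf x * suc (d′ parent x)) (λ x → sum λ y → leaf x * leaf y * d′ x y))) ⟩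
    E + (E + innerDistances)
      ≡⟨ regroup E innerDistances ⟩
    innerDistances + 2 * E
      ≡⟨ cong (λ e → innerDistances + 2 * e) E≡ ⟩
    innerDistances + 2 * (sum leaf + parentDistances) ∎
    where
    open ≡-Reasoning
    E : ℕ
    E = sum λ y → leaf y * suc (d′ parent y)
    E≡ : E ≡ sum leaf + parentDistances
    E≡ = trans (sum-cong-≗ (λ y → *-suc (leaf y) (d′ parent y))) (∑-distrib-+ leaf (λ y → leaf y * d′ parent y))
    regroup : ∀ e c → e + (e + c) ≡ c + 2 * e
    regroup = solve-∀
    dist-ℓ′ : ∀ y → dist T ℓ (ι y) ≡ suc (d′ parent y)
    dist-ℓ′ y = trans (dist-sym T ℓ (ι y)) (trans (dist-ℓ y) (cong suc (dist-sym T′ y parent)))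
    row-ℓ : sum (λ v → isLeaf T ℓ * isLeaf T v * dist T ℓ v) ≡ E
    row-ℓ = begin
      sum (λ v → isLeaf T ℓ * isLeaf T v * dist T ℓ v)
        ≡⟨ sum-remove {i = ℓ} (λ v → isLeaf T ℓ * isLeaf T v * dist T ℓ v) ⟩
      isLeaf T ℓ * isLeaf T ℓ * dist T ℓ ℓ + sum (λ y → isLeaf T ℓ * leaf y * dist T ℓ (ι y))
        ≡⟨ cong₂ _+_ (trans (cong (isLeaf T ℓ * isLeaf T ℓ *_) (dist-self T ℓ)) (*-zeroʳ (isLeaf T ℓ * isLeaf T ℓ)))
                     (sum-cong-≗ (λ y → cong₂ (λ a b → a * leaf y * b) isLeaf-ℓ (dist-ℓ′ y))) ⟩
      0 + sum (λ y → 1 * leaf y * suc (d′ parent y))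
        ≡⟨ sum-cong-≗ (λ y → cong (_* suc (d′ parent y)) (*-identityˡ (leaf y))) ⟩
      E ∎
    row-ι : ∀ x → sum (λ v → leaf x * isLeaf T v * dist T (ι x) v)
                ≡ leaf x * suc (d′ parent x) + sum (λ y → leaf x * leaf y * d′ x y)
    row-ι x = trans (sum-remove {i = ℓ} (λ v → leaf x * isLeaf T v * dist T (ι x) v)) (cong₂ _+_
      (trans (cong₂ (λ a b → leaf x * a * b) isLeaf-ℓ (trans (dist-ℓ x) (cong suc (dist-sym T′ x parent))))
             (cong (_* suc (d′ parent x)) (*-identityʳ (leaf x))))
      (sum-cong-≗ (λ y → cong (leaf x * leaf y *_) (dist-ι diam′ x y))))

  isLeaf-other : ∀ x → x ≢ parent → isLeaf T′ x ≡ leaf x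
  isLeaf-other x x≢parent = begin
    isLeaf T′ x                    ≡⟨ isLeaf≡leafIndicator T′ x ⟩
    leafIndicator (deg T′ x)       ≡⟨ cong leafIndicator (deg-other x x≢parent) ⟨
    leafIndicator (deg T (ι x))    ≡⟨ isLeaf≡leafIndicator T (ι x) ⟨
    leaf x                         ∎
    where open ≡-Reasoning

  excessDegree-exchange : sum (λ x → deg T (ι x) ∸ 2) + (deg T′ parent ∸ 2) ≡ excessDegree T′ + (deg T p ∸ 2)
  excessDegree-exchange =
    sum-agree-except parent (λ x → deg T (ι x) ∸ 2) (λ x → deg T′ x ∸ 2) (λ x x≢ → cong (_∸ 2) (deg-other x x≢))

  deg′≤deg : ∀ x → deg T′ x ≤ deg T (ι x)
  deg′≤deg x = subst (deg T′ x ≤_) (sym (deg-ι x)) (m≤n+m (deg T′ x) (count (adj T (ι x) ℓ)))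

  branchingOnlyAt′ : ∀ c → BranchingOnlyAt T (ι c) → BranchingOnlyAt T′ c
  branchingOnlyAt′ c only w w≢c = ≤-trans (deg′≤deg w) (only (ι w) (w≢c ∘ punchIn-injective ℓ w c))

  deg-ℓ≤2 : deg T ℓ ≤ 2
  deg-ℓ≤2 = subst (_≤ 2) (sym deg-ℓ) (s≤s z≤n)

  parent-cases : deg T′ parent ≡ 1 ⊎ 2 ≤ deg T′ parent
  parent-cases with deg T′ parent | connected⇒0<deg T′ (proj₁ tree′) {fzero} {fsuc fzero} (λ ()) parent
  ... | suc zero    | _ = inj₁ refl
  ... | suc (suc _) | _ = inj₂ (s≤s (s≤s z≤n))

  module ParentBecomesLeaf (deg′-parent : deg T′ parent ≡ 1) where

    deg-p : deg T p ≡ 2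
    deg-p = trans deg-parent (cong suc deg′-parent)

    isLeaf′ : ∀ x → isLeaf T′ x ≡ leaf x + indicator parent x
    isLeaf′ x with x ≟ parent
    ... | yes refl = trans (isLeaf≡leafIndicator T′ parent) (trans (cong leafIndicator deg′-parent)
                       (cong (_+ 1) (sym (trans (isLeaf≡leafIndicator T p) (cong leafIndicator deg-p)))))
    ... | no x≢parent = trans (isLeaf-other x x≢parent) (sym (+-identityʳ (leaf x)))

    leafCount′ : leafCount T′ ≡ suc (sum leaf)
    leafCount′ = begin
      leafCount T′                                ≡⟨ sum-cong-≗ isLeaf′ ⟩
      sum (λ x → leaf x + indicator parent x)     ≡⟨ ∑-distrib-+ leaf (indicator parent) ⟩
      sum leaf + sum (indicator parent)           ≡⟨ cong (sum leaf +_) (sum-indicator parent) ⟩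
      sum leaf + 1                                ≡⟨ +-comm (sum leaf) 1 ⟩
      suc (sum leaf)                              ∎
      where open ≡-Reasoning

    leafDistanceSum′ : leafDistanceSum T′ ≡ innerDistances + 2 * parentDistances
    leafDistanceSum′ =
      trans (sum-cong-≗ (λ x → sum-cong-≗ (λ y → cong₂ (λ a b → a * b * d′ x y) (isLeaf′ x) (isLeaf′ y))))
            (sum²-+indicator leaf parent d′ (dist-self T′) (dist-sym T′))

    distanceToLeaves′ : ∀ c → distanceToLeaves T′ c ≡ sum (λ y → leaf y * d′ c y) + d′ c parent
    distanceToLeaves′ c = begin
      distanceToLeaves T′ c                                          ≡⟨ sum-cong-≗ (λ y → trans (cong (_* d′ c y) (isLeaf′ y)) (*-distribʳ-+ (d′ c y) (leaf y) _)) ⟩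
      sum (λ y → leaf y * d′ c y + indicator parent y * d′ c y)      ≡⟨ ∑-distrib-+ (λ y → leaf y * d′ c y) (λ y → indicator parent y * d′ c y) ⟩
      sum (λ y → leaf y * d′ c y) + sum (λ y → indicator parent y * d′ c y)
                                                                     ≡⟨ cong (sum (λ y → leaf y * d′ c y) +_) (sum-indicator-* parent (d′ c)) ⟩
      sum (λ y → leaf y * d′ c y) + d′ c parent                      ∎
      where open ≡-Reasoning

    excessDegree≡ : excessDegree T ≡ excessDegree T′
    excessDegree≡ = trans excessDegree-step (+-cancelʳ-≡ _ _ _ (begin
      sum (λ x → deg T (ι x) ∸ 2) + 0                             ≡⟨ cong (λ d → sum (λ x → deg T (ι x) ∸ 2) + (d ∸ 2)) deg′-parent ⟨
      sum (λ x → deg T (ι x) ∸ 2) + (deg T′ parent ∸ 2)           ≡⟨ excessDegree-exchange ⟩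
      excessDegree T′ + (deg T p ∸ 2)                             ≡⟨ cong (λ d → excessDegree T′ + (d ∸ 2)) deg-p ⟩
      excessDegree T′ + 0                                         ∎))
      where open ≡-Reasoning

    distanceToLeaves≡ : ∀ c → distanceToLeaves T (ι c) ≡ suc (distanceToLeaves T′ c)
    distanceToLeaves≡ c =
      trans (distanceToLeaves-step c) (cong suc (trans (+-comm (d′ c parent) _) (sym (distanceToLeaves′ c))))

    leafDistanceSum≡ : leafDistanceSum T ≡ leafDistanceSum T′ + 2 * sum leaf
    leafDistanceSum≡ = begin
      leafDistanceSum T                                                ≡⟨ leafDistanceSum-step ⟩
      innerDistances + 2 * (sum leaf + parentDistances)                ≡⟨ regroup innerDistances (sum leaf) parentDistances ⟩
      (innerDistances + 2 * parentDistances) + 2 * sum leaf            ≡⟨ cong (_+ 2 * sum leaf) leafDistanceSum′ ⟨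
      leafDistanceSum T′ + 2 * sum leaf                                ∎
      where
      open ≡-Reasoning
      regroup : ∀ c q b → c + 2 * (q + b) ≡ (c + 2 * b) + 2 * q
      regroup = solve-∀

    branchingOnlyAt-lift : ∀ c → BranchingOnlyAt T′ c → BranchingOnlyAt T (ι c)
    branchingOnlyAt-lift c only u u≢ιc with punchIn-or-self ℓ u
    ... | inj₁ refl = deg-ℓ≤2
    ... | inj₂ (x , refl) with x ≟ parent
    ...   | yes refl      = ≤-reflexive deg-p
    ...   | no  x≢parent  = subst (_≤ 2) (sym (deg-other x x≢parent)) (only x (u≢ιc ∘ cong ι))

    atMostOneBranching⇔ : AtMostOneBranching T ⇔ AtMostOneBranching T′
    atMostOneBranching⇔ = mk⇔
      (λ amo x y 3≤x 3≤y → punchIn-injective ℓ x y (amo (ι x) (ι y) (≤-trans 3≤x (deg′≤deg x)) (≤-trans 3≤y (deg′≤deg y))))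
      (λ amo u v 3≤u 3≤v → lift amo u v 3≤u 3≤v)
      where
      branching-ι : ∀ u → 3 ≤ deg T u → ∃ λ x → u ≡ ι x × 3 ≤ deg T′ x
      branching-ι u 3≤u with punchIn-or-self ℓ u
      ... | inj₁ refl = ⊥-elim (<-irrefl refl (≤-trans 3≤u deg-ℓ≤2))
      ... | inj₂ (x , refl) with x ≟ parent
      ...   | yes refl     = ⊥-elim (<-irrefl refl (subst (3 ≤_) deg-p 3≤u))
      ...   | no  x≢parent = x , refl , subst (3 ≤_) (deg-other x x≢parent) 3≤u
      lift : AtMostOneBranching T′ → AtMostOneBranching T
      lift amo u v 3≤u 3≤v with branching-ι u 3≤u | branching-ι v 3≤v
      ... | x , refl , 3≤x | y , refl , 3≤y = cong ι (amo x y 3≤x 3≤y)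

  module ParentStaysInner (2≤deg′-parent : 2 ≤ deg T′ parent) where

    3≤deg-p : 3 ≤ deg T p
    3≤deg-p = subst (3 ≤_) (sym deg-parent) (s≤s 2≤deg′-parent)

    isLeaf′ : ∀ x → isLeaf T′ x ≡ leaf x
    isLeaf′ x with x ≟ parent
    ... | no x≢parent = isLeaf-other x x≢parent
    ... | yes refl = trans (isLeaf≡leafIndicator T′ parent) (trans (not-leaf 2≤deg′-parent)
                       (sym (trans (isLeaf≡leafIndicator T p) (not-leaf (≤-trans (n≤1+n 2) 3≤deg-p)))))
      where
      not-leaf : ∀ {d} → 2 ≤ d → leafIndicator d ≡ 0
      not-leaf (s≤s (s≤s _)) = refl

    leafCount′ : leafCount T′ ≡ sum leaf
    leafCount′ = sum-cong-≗ isLeaf′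

    leafDistanceSum′ : leafDistanceSum T′ ≡ innerDistances
    leafDistanceSum′ = sum-cong-≗ (λ x → sum-cong-≗ (λ y → cong₂ (λ a b → a * b * d′ x y) (isLeaf′ x) (isLeaf′ y)))

    distanceToLeaves′ : ∀ c → distanceToLeaves T′ c ≡ sum (λ y → leaf y * d′ c y)
    distanceToLeaves′ c = sum-cong-≗ (λ y → cong (_* d′ c y) (isLeaf′ y))

    excessDegree≡ : excessDegree T ≡ suc (excessDegree T′)
    excessDegree≡ = trans excessDegree-step (shift (deg T′ parent) 2≤deg′-parent
      (trans excessDegree-exchange (cong (λ d → excessDegree T′ + (d ∸ 2)) deg-parent)))
      where
      shift : ∀ r → 2 ≤ r → sum (λ x → deg T (ι x) ∸ 2) + (r ∸ 2) ≡ excessDegree T′ + (suc r ∸ 2) →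
              sum (λ x → deg T (ι x) ∸ 2) ≡ suc (excessDegree T′)
      shift (suc zero)    (s≤s ()) _
      shift (suc (suc r)) _        e = +-cancelʳ-≡ r _ _ (trans e (+-suc (excessDegree T′) r))

    distanceToLeaves≡ : ∀ c → distanceToLeaves T (ι c) ≡ suc (d′ c parent + distanceToLeaves T′ c)
    distanceToLeaves≡ c = trans (distanceToLeaves-step c) (cong (λ a → suc (d′ c parent + a)) (sym (distanceToLeaves′ c)))

    leafDistanceSum≡ : leafDistanceSum T ≡ leafDistanceSum T′ + (2 * sum leaf + 2 * distanceToLeaves T′ parent)
    leafDistanceSum≡ = begin
      leafDistanceSum T                                                ≡⟨ leafDistanceSum-step ⟩
      innerDistances + 2 * (sum leaf + parentDistances)                ≡⟨ cong (innerDistances +_) (*-distribˡ-+ 2 (sum leaf) _) ⟩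
      innerDistances + (2 * sum leaf + 2 * parentDistances)            ≡⟨ cong₂ (λ c b → c + (2 * sum leaf + 2 * b)) leafDistanceSum′ (distanceToLeaves′ parent) ⟨
      leafDistanceSum T′ + (2 * sum leaf + 2 * distanceToLeaves T′ parent) ∎
      where open ≡-Reasoning

    branchingOnlyAt⇒parent : ∀ c → BranchingOnlyAt T (ι c) → c ≡ parent
    branchingOnlyAt⇒parent c only with c ≟ parent
    ... | yes c≡parent = c≡parent
    ... | no  c≢parent = ⊥-elim (<-irrefl refl (≤-trans 3≤deg-p (only p (c≢parent ∘ sym ∘ punchIn-injective ℓ parent c))))

    branchingOnlyAt-lift : BranchingOnlyAt T′ parent → BranchingOnlyAt T p
    branchingOnlyAt-lift only u u≢p with punchIn-or-self ℓ u
    ... | inj₁ refl       = deg-ℓ≤2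
    ... | inj₂ (x , refl) = subst (_≤ 2) (sym (deg-other x (u≢p ∘ cong ι))) (only x (u≢p ∘ cong ι))

    atMostOneBranching⇒branchingOnlyAt : AtMostOneBranching T → BranchingOnlyAt T′ parent
    atMostOneBranching⇒branchingOnlyAt amo w w≢parent with 3 ≤? deg T′ w
    ... | yes 3≤w = ⊥-elim (w≢parent (punchIn-injective ℓ w parent (amo (ι w) p (≤-trans 3≤w (deg′≤deg w)) 3≤deg-p)))
    ... | no  3≰w = ≤-pred (≰⇒> 3≰w)

-- Induction on the order

module TwoVertexTree (T : Graph 2) (tree : IsTree T) where

  adj-01 : adj T fzero (fsuc fzero) ≡ true
  adj-01 = first-edge (proj₁ tree fzero (fsuc fzero))
    where
    first-edge : Walk T fzero (fsuc fzero) → adj T fzero (fsuc fzero) ≡ true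
    first-edge (step {w = fzero}      e _) = ⊥-elim (adj-irrefl T e)
    first-edge (step {w = fsuc fzero} e _) = e

  adj-10 : adj T (fsuc fzero) fzero ≡ true
  adj-10 = trans (Graph.sym T _ _) adj-01

  deg≡1 : ∀ u → deg T u ≡ 1
  deg≡1 fzero        rewrite deg-sum T fzero        | Graph.irref T fzero        | adj-01 = refl
  deg≡1 (fsuc fzero) rewrite deg-sum T (fsuc fzero) | Graph.irref T (fsuc fzero) | adj-10 = refl

  isLeaf≡1 : ∀ u → isLeaf T u ≡ 1
  isLeaf≡1 u = trans (isLeaf≡leafIndicator T u) (cong leafIndicator (deg≡1 u))

  dist-01 : dist T fzero (fsuc fzero) ≡ 1
  dist-01 = trans (dist-sum T fzero (fsuc fzero))
                  (cong (λ b → 1 + (unreached b + 0)) (within-complete T {1} (reach-snoc reach-refl adj-01)))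

  dist≡ : ∀ u v → dist T u v ≡ unreached (does (u ≟ v))
  dist≡ fzero        fzero        = dist-self T fzero
  dist≡ fzero        (fsuc fzero) = dist-01
  dist≡ (fsuc fzero) fzero        = trans (dist-sym T (fsuc fzero) fzero) dist-01
  dist≡ (fsuc fzero) (fsuc fzero) = dist-self T (fsuc fzero)

  leafCount≡2 : leafCount T ≡ 2
  leafCount≡2 rewrite isLeaf≡1 fzero | isLeaf≡1 (fsuc fzero) = refl

  excessDegree≡0 : excessDegree T ≡ 0
  excessDegree≡0 rewrite deg≡1 fzero | deg≡1 (fsuc fzero) = refl

  distance-term : ∀ u v → isLeaf T u * isLeaf T v * dist T u v ≡ unreached (does (u ≟ v))
  distance-term u v rewrite isLeaf≡1 u | isLeaf≡1 v | dist≡ u v = +-identityʳ _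

  leafDistanceSum≡2 : leafDistanceSum T ≡ 2
  leafDistanceSum≡2 = sum-cong-≗ (λ u → sum-cong-≗ (distance-term u))

  distanceToLeaves≡1 : ∀ c → distanceToLeaves T c ≡ 1
  distanceToLeaves≡1 c = trans (sum-cong-≗ weighted-distance) (row c)
    where
    weighted-distance : ∀ v → isLeaf T v * dist T c v ≡ unreached (does (c ≟ v))
    weighted-distance v rewrite isLeaf≡1 v | dist≡ c v = +-identityʳ _
    row : ∀ c → sum (λ v → unreached (does (c ≟ v))) ≡ 1
    row fzero        = refl
    row (fsuc fzero) = refl

  branchingOnlyAt : ∀ c → BranchingOnlyAt T c
  branchingOnlyAt c w _ = ≤-trans (≤-reflexive (deg≡1 w)) (s≤s z≤n)

  atMostOneBranching : AtMostOneBranching T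
  atMostOneBranching = branchingOnlyAt⇒atMostOneBranching T fzero (branchingOnlyAt fzero)

leafCount≡2+excessDegree : ∀ k (T : Graph (suc (suc k))) → IsTree T → leafCount T ≡ 2 + excessDegree T
leafCount≡2+excessDegree zero    T tree = trans leafCount≡2 (cong (2 +_) (sym excessDegree≡0))
  where open TwoVertexTree T tree
leafCount≡2+excessDegree (suc k) T tree with leaf-avoiding T tree fzero {fsuc fzero} (λ ())
... | ℓ , _ , deg-ℓ with parent-cases
  where open LeafStep T tree ℓ deg-ℓ
...   | inj₁ deg′≡1 = begin
  leafCount T                   ≡⟨ trans leafCount-step (sym leafCount′) ⟩
  leafCount T′                  ≡⟨ leafCount≡2+excessDegree k T′ tree′ ⟩
  2 + excessDegree T′           ≡⟨ cong (2 +_) excessDegree≡ ⟨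
  2 + excessDegree T            ∎
  where
  open ≡-Reasoning
  open LeafStep T tree ℓ deg-ℓ
  open ParentBecomesLeaf deg′≡1
...   | inj₂ 2≤deg′ = begin
  leafCount T                   ≡⟨ trans leafCount-step (cong suc (sym leafCount′)) ⟩
  suc (leafCount T′)            ≡⟨ cong suc (leafCount≡2+excessDegree k T′ tree′) ⟩
  2 + suc (excessDegree T′)     ≡⟨ cong (2 +_) excessDegree≡ ⟨
  2 + excessDegree T            ∎
  where
  open ≡-Reasoning
  open LeafStep T tree ℓ deg-ℓ
  open ParentStaysInner 2≤deg′

other-vertex : ∀ {k} (c : Fin (suc (suc k))) → ∃ λ v → v ≢ c
other-vertex fzero    = fsuc fzero , λ ()
other-vertex (fsuc _) = fzero , λ ()

distanceToLeaves-bound : ∀ k (T : Graph (suc (suc k))) → IsTree T → ∀ c → suc k ≤ distanceToLeaves T c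
distanceToLeaves-bound zero    T tree c = ≤-reflexive (sym (distanceToLeaves≡1 c))
  where open TwoVertexTree T tree
distanceToLeaves-bound (suc k) T tree c with leaf-avoiding T tree c (proj₂ (other-vertex c))
... | ℓ , ℓ≢c , deg-ℓ = subst (λ c → suc (suc k) ≤ distanceToLeaves T c) (punchIn-punchOut ℓ≢c) bound
  where
  open LeafStep T tree ℓ deg-ℓ
  c′ : Fin (suc (suc k))
  c′ = punchOut ℓ≢c
  IH : suc k ≤ distanceToLeaves T′ c′
  IH = distanceToLeaves-bound k T′ tree′ c′
  bound : suc (suc k) ≤ distanceToLeaves T (ι c′)
  bound with parent-cases
  ... | inj₁ deg′≡1 = subst (suc (suc k) ≤_) (sym (distanceToLeaves≡ c′)) (s≤s IH)
    where open ParentBecomesLeaf deg′≡1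
  ... | inj₂ 2≤deg′ = subst (suc (suc k) ≤_) (sym (distanceToLeaves≡ c′)) (s≤s (≤-trans IH (m≤n+m _ (d′ c′ parent))))
    where open ParentStaysInner 2≤deg′

distanceToLeaves-tight : ∀ k (T : Graph (suc (suc k))) → IsTree T → ∀ c →
                         distanceToLeaves T c ≡ suc k ⇔ BranchingOnlyAt T c
distanceToLeaves-tight zero    T tree c = mk⇔ (λ _ → branchingOnlyAt c) (λ _ → distanceToLeaves≡1 c)
  where open TwoVertexTree T tree
distanceToLeaves-tight (suc k) T tree c with leaf-avoiding T tree c (proj₂ (other-vertex c))
... | ℓ , ℓ≢c , deg-ℓ =
  subst (λ c → distanceToLeaves T c ≡ suc (suc k) ⇔ BranchingOnlyAt T c) (punchIn-punchOut ℓ≢c) tight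
  where
  open LeafStep T tree ℓ deg-ℓ
  c′ : Fin (suc (suc k))
  c′ = punchOut ℓ≢c
  IH : distanceToLeaves T′ c′ ≡ suc k ⇔ BranchingOnlyAt T′ c′
  IH = distanceToLeaves-tight k T′ tree′ c′
  tight : distanceToLeaves T (ι c′) ≡ suc (suc k) ⇔ BranchingOnlyAt T (ι c′)
  tight with parent-cases
  ... | inj₁ deg′≡1 = mk⇔
    (λ e → branchingOnlyAt-lift c′ (Equivalence.to IH (suc-injective (trans (sym (distanceToLeaves≡ c′)) e))))
    (λ only → trans (distanceToLeaves≡ c′) (cong suc (Equivalence.from IH (branchingOnlyAt′ c′ only))))
    where open ParentBecomesLeaf deg′≡1
  ... | inj₂ 2≤deg′ = mk⇔ to from
    where
    open ParentStaysInner 2≤deg′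
    to : distanceToLeaves T (ι c′) ≡ suc (suc k) → BranchingOnlyAt T (ι c′)
    to e with +-≤-tight z≤n (distanceToLeaves-bound k T′ tree′ c′) (suc-injective (trans (sym (distanceToLeaves≡ c′)) e))
    ... | d≡0 , A′≡ = subst (BranchingOnlyAt T ∘ ι) (sym c′≡parent)
                            (branchingOnlyAt-lift (subst (BranchingOnlyAt T′) c′≡parent (Equivalence.to IH A′≡)))
      where
      c′≡parent : c′ ≡ parent
      c′≡parent = dist≡0⇒≡ T′ c′ parent d≡0
    from : BranchingOnlyAt T (ι c′) → distanceToLeaves T (ι c′) ≡ suc (suc k)
    from only = trans (distanceToLeaves≡ c′) (cong suc (cong₂ _+_ d′≡0 (Equivalence.from IH (branchingOnlyAt′ c′ only))))
      where
      d′≡0 : d′ c′ parent ≡ 0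
      d′≡0 = trans (cong (d′ c′) (sym (branchingOnlyAt⇒parent c′ only))) (dist-self T′ c′)

module LeafDistanceStep {k : ℕ} (T : Graph (suc (suc (suc k)))) (tree : IsTree T)
                        (ℓ : Fin (suc (suc (suc k)))) (deg-ℓ : deg T ℓ ≡ 1) where

  open LeafStep T tree ℓ deg-ℓ public

  leafCount-but-ℓ : sum leaf ≡ suc (excessDegree T)
  leafCount-but-ℓ = suc-injective (trans (sym leafCount-step) (leafCount≡2+excessDegree (suc k) T tree))

  module ParentBecomesLeafStep (deg′≡1 : deg T′ parent ≡ 1) where
    open ParentBecomesLeaf deg′≡1 public

    leafDistanceSum-recurrence : leafDistanceSum T ≡ leafDistanceSum T′ + 2 * suc (excessDegree T′)
    leafDistanceSum-recurrence = trans leafDistanceSum≡ (cong (λ q → leafDistanceSum T′ + 2 * q) (trans leafCount-but-ℓ (cong suc excessDegree≡)))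

    bound-recurrence : 2 * (suc (suc k) * suc (excessDegree T)) ≡ 2 * (suc k * suc (excessDegree T′)) + 2 * suc (excessDegree T′)
    bound-recurrence = trans (cong (λ x → 2 * (suc (suc k) * suc x)) excessDegree≡) (peel (suc k) (suc (excessDegree T′)))
      where
      peel : ∀ K Y → 2 * (suc K * Y) ≡ 2 * (K * Y) + 2 * Y
      peel = solve-∀

  module ParentStaysInnerStep (2≤deg′ : 2 ≤ deg T′ parent) where
    open ParentStaysInner 2≤deg′ public

    leafDistanceSum-recurrence : leafDistanceSum T ≡ leafDistanceSum T′ + (2 * suc (excessDegree T) + 2 * distanceToLeaves T′ parent)
    leafDistanceSum-recurrence = trans leafDistanceSum≡ (cong (λ q → leafDistanceSum T′ + (2 * q + 2 * distanceToLeaves T′ parent)) leafCount-but-ℓ)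

    bound-recurrence : 2 * (suc (suc k) * suc (excessDegree T)) ≡ 2 * (suc k * suc (excessDegree T′)) + (2 * suc (excessDegree T) + 2 * suc k)
    bound-recurrence = begin
      2 * (suc (suc k) * suc (excessDegree T))            ≡⟨ cong (λ x → 2 * (suc (suc k) * suc x)) excessDegree≡ ⟩
      2 * (suc (suc k) * suc (suc (excessDegree T′)))     ≡⟨ peel (suc k) (excessDegree T′) ⟩
      2 * (suc k * suc (excessDegree T′)) + (2 * suc (suc (excessDegree T′)) + 2 * suc k)
        ≡⟨ cong (λ x → 2 * (suc k * suc (excessDegree T′)) + (2 * suc x + 2 * suc k)) excessDegree≡ ⟨
      2 * (suc k * suc (excessDegree T′)) + (2 * suc (excessDegree T) + 2 * suc k) ∎
      where
      open ≡-Reasoning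
      peel : ∀ K Y → 2 * (suc K * suc (suc Y)) ≡ 2 * (K * suc Y) + (2 * suc (suc Y) + 2 * K)
      peel = solve-∀

leafDistanceSum-bound : ∀ k (T : Graph (suc (suc k))) → IsTree T →
                        2 * (suc k * suc (excessDegree T)) ≤ leafDistanceSum T
leafDistanceSum-bound zero    T tree =
  ≤-reflexive (trans (cong (λ x → 2 * (1 * suc x)) excessDegree≡0) (sym leafDistanceSum≡2))
  where open TwoVertexTree T tree
leafDistanceSum-bound (suc k) T tree with leaf-avoiding T tree fzero {fsuc fzero} (λ ())
... | ℓ , _ , deg-ℓ with parent-cases
  where open LeafDistanceStep T tree ℓ deg-ℓ
...   | inj₁ deg′≡1 = begin
  2 * (suc (suc k) * suc (excessDegree T))                           ≡⟨ bound-recurrence ⟩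
  2 * (suc k * suc (excessDegree T′)) + 2 * suc (excessDegree T′)    ≤⟨ +-monoˡ-≤ (2 * suc (excessDegree T′)) (leafDistanceSum-bound k T′ tree′) ⟩
  leafDistanceSum T′ + 2 * suc (excessDegree T′)                     ≡⟨ leafDistanceSum-recurrence ⟨
  leafDistanceSum T                                                  ∎
  where
  open ≤-Reasoning
  open LeafDistanceStep T tree ℓ deg-ℓ
  open ParentBecomesLeafStep deg′≡1
...   | inj₂ 2≤deg′ = begin
  2 * (suc (suc k) * suc (excessDegree T))
    ≡⟨ bound-recurrence ⟩
  2 * (suc k * suc (excessDegree T′)) + (2 * suc (excessDegree T) + 2 * suc k)
    ≤⟨ +-mono-≤ (leafDistanceSum-bound k T′ tree′) (+-monoʳ-≤ (2 * suc (excessDegree T)) (*-monoʳ-≤ 2 (distanceToLeaves-bound k T′ tree′ parent))) ⟩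
  leafDistanceSum T′ + (2 * suc (excessDegree T) + 2 * distanceToLeaves T′ parent)
    ≡⟨ leafDistanceSum-recurrence ⟨
  leafDistanceSum T
    ∎
  where
  open ≤-Reasoning
  open LeafDistanceStep T tree ℓ deg-ℓ
  open ParentStaysInnerStep 2≤deg′

leafDistanceSum-tight : ∀ k (T : Graph (suc (suc k))) → IsTree T →
                        leafDistanceSum T ≡ 2 * (suc k * suc (excessDegree T)) ⇔ AtMostOneBranching T
leafDistanceSum-tight zero    T tree =
  mk⇔ (λ _ → atMostOneBranching) (λ _ → trans leafDistanceSum≡2 (cong (λ x → 2 * (1 * suc x)) (sym excessDegree≡0)))
  where open TwoVertexTree T tree
leafDistanceSum-tight (suc k) T tree with leaf-avoiding T tree fzero {fsuc fzero} (λ ())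
... | ℓ , _ , deg-ℓ with parent-cases
  where open LeafDistanceStep T tree ℓ deg-ℓ
...   | inj₁ deg′≡1 = mk⇔
  (λ e → Equivalence.from atMostOneBranching⇔ (Equivalence.to IH
           (+-cancelʳ-≡ (2 * suc (excessDegree T′)) (leafDistanceSum T′) (2 * (suc k * suc (excessDegree T′)))
                        (trans (sym leafDistanceSum-recurrence) (trans e bound-recurrence)))))
  (λ amo → trans leafDistanceSum-recurrence
                 (trans (cong (_+ 2 * suc (excessDegree T′)) (Equivalence.from IH (Equivalence.to atMostOneBranching⇔ amo)))
                        (sym bound-recurrence)))
  where
  open LeafDistanceStep T tree ℓ deg-ℓ
  open ParentBecomesLeafStep deg′≡1
  IH : leafDistanceSum T′ ≡ 2 * (suc k * suc (excessDegree T′)) ⇔ AtMostOneBranching T′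
  IH = leafDistanceSum-tight k T′ tree′
...   | inj₂ 2≤deg′ = mk⇔ to from
  where
  open LeafDistanceStep T tree ℓ deg-ℓ
  open ParentStaysInnerStep 2≤deg′
  IH : leafDistanceSum T′ ≡ 2 * (suc k * suc (excessDegree T′)) ⇔ AtMostOneBranching T′
  IH = leafDistanceSum-tight k T′ tree′
  tight-parent : distanceToLeaves T′ parent ≡ suc k ⇔ BranchingOnlyAt T′ parent
  tight-parent = distanceToLeaves-tight k T′ tree′ parent
  R : ℕ
  R = 2 * suc (excessDegree T)
  to : leafDistanceSum T ≡ 2 * (suc (suc k) * suc (excessDegree T)) → AtMostOneBranching T
  to e = branchingOnlyAt⇒atMostOneBranching T p (branchingOnlyAt-lift (Equivalence.to tight-parent B≡K))
    where
    B : ℕ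
    B = distanceToLeaves T′ parent
    R+2B≡R+2K : R + 2 * B ≡ R + 2 * suc k
    R+2B≡R+2K = proj₂ (+-≤-tight {a = 2 * (suc k * suc (excessDegree T′))} {b = leafDistanceSum T′}
                                 {c = R + 2 * suc k} {d = R + 2 * B}
                                 (leafDistanceSum-bound k T′ tree′)
                                 (+-monoʳ-≤ R (*-monoʳ-≤ 2 (distanceToLeaves-bound k T′ tree′ parent)))
                                 (trans (sym leafDistanceSum-recurrence) (trans e bound-recurrence)))
    B≡K : B ≡ suc k
    B≡K = *-cancelˡ-≡ B (suc k) 2 (+-cancelˡ-≡ R (2 * B) (2 * suc k) R+2B≡R+2K)
  from : AtMostOneBranching T → leafDistanceSum T ≡ 2 * (suc (suc k) * suc (excessDegree T))
  from amo = trans leafDistanceSum-recurrence (trans (cong₂ (λ s b → s + (R + 2 * b)) S′-tight B-tight) (sym bound-recurrence))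
    where
    only : BranchingOnlyAt T′ parent
    only = atMostOneBranching⇒branchingOnlyAt amo
    S′-tight : leafDistanceSum T′ ≡ 2 * (suc k * suc (excessDegree T′))
    S′-tight = Equivalence.from IH (branchingOnlyAt⇒atMostOneBranching T′ parent only)
    B-tight : distanceToLeaves T′ parent ≡ suc k
    B-tight = Equivalence.from tight-parent only

-- The terminal Wiener index

TW-bound : ∀ k (T : Graph (suc (suc k))) → IsTree T → suc k * suc (excessDegree T) ≤ TW T
TW-bound k T tree = *-cancelˡ-≤ 2 (subst (2 * (suc k * suc (excessDegree T)) ≤_) (sym (2*TW≡leafDistanceSum T))
                                         (leafDistanceSum-bound k T tree))

TW-tight : ∀ k (T : Graph (suc (suc k))) → IsTree T → TW T ≡ suc k * suc (excessDegree T) ⇔ AtMostOneBranching T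
TW-tight k T tree = mk⇔
  (λ e → Equivalence.to tight (trans (sym (2*TW≡leafDistanceSum T)) (cong (2 *_) e)))
  (λ amo → *-cancelˡ-≡ (TW T) _ 2 (trans (2*TW≡leafDistanceSum T) (Equivalence.from tight amo)))
  where
  tight : leafDistanceSum T ≡ 2 * (suc k * suc (excessDegree T)) ⇔ AtMostOneBranching T
  tight = leafDistanceSum-tight k T tree

module _ {n : ℕ} (G : Graph n) where

  deg∸2≤excessDegree : ∀ c → deg G c ∸ 2 ≤ excessDegree G
  deg∸2≤excessDegree = term≤sum (λ u → deg G u ∸ 2)


  starlike⇒branchingOnlyAt : ∀ {Δ} → (S : Starlike G Δ) → BranchingOnlyAt G (proj₁ S)
  starlike⇒branchingOnlyAt (v , _ , _ , unique) w w≢v with 3 ≤? deg G w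
  ... | yes 3≤w = ⊥-elim (w≢v (unique w 3≤w))
  ... | no  3≰w = ≤-pred (≰⇒> 3≰w)

branchingOnlyAt⇒excessDegree : ∀ {m} (G : Graph (suc m)) c → BranchingOnlyAt G c → excessDegree G ≡ deg G c ∸ 2
branchingOnlyAt⇒excessDegree {m} G c only = begin
  excessDegree G                                           ≡⟨ sum-remove {i = c} (λ u → deg G u ∸ 2) ⟩
  deg G c ∸ 2 + sum (λ x → deg G (punchIn c x) ∸ 2)        ≡⟨ cong (deg G c ∸ 2 +_) (sum-cong-≗ (λ x → m≤n⇒m∸n≡0 (only _ (punchInᵢ≢i c x)))) ⟩
  deg G c ∸ 2 + sum {m} (λ _ → 0)                          ≡⟨ cong (deg G c ∸ 2 +_) (sum-replicate-zero m) ⟩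
  deg G c ∸ 2 + 0                                          ≡⟨ +-identityʳ _ ⟩
  deg G c ∸ 2                                              ∎
  where open ≡-Reasoning

theorem4p4 : (n Δ : ℕ) → 3 ≤ Δ → (T : Graph n) → IsTree T → MaxDegree T Δ →
    ((n ∸ 1) * (Δ ∸ 1) ≤ TW T)
    × (TW T ≡ (n ∸ 1) * (Δ ∸ 1) ⇔ Starlike T Δ)
theorem4p4 zero          Δ 3≤Δ T tree ((() , _) , _)
theorem4p4 (suc zero)    Δ 3≤Δ T tree ((fzero , deg≡Δ) , _) =
  contradiction (subst (3 ≤_) (trans (sym deg≡Δ) deg≡0) 3≤Δ) λ ()
  where
  deg≡0 : deg T fzero ≡ 0
  deg≡0 = trans (deg-sum T fzero) (cong (λ b → count b + 0) (Graph.irref T fzero))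
theorem4p4 (suc (suc k)) Δ 3≤Δ T tree ((c , deg≡Δ) , _) = bound , mk⇔ to from
  where
  3≤deg-c : 3 ≤ deg T c
  3≤deg-c = subst (3 ≤_) (sym deg≡Δ) 3≤Δ
  suc[Δ∸2]≡Δ∸1 : suc (Δ ∸ 2) ≡ Δ ∸ 1
  suc[Δ∸2]≡Δ∸1 = suc[∸2]≡∸1 (≤-trans (n≤1+n 2) 3≤Δ)
  Δ∸1≤ : Δ ∸ 1 ≤ suc (excessDegree T)
  Δ∸1≤ = subst (_≤ suc (excessDegree T)) suc[Δ∸2]≡Δ∸1
               (s≤s (subst (λ d → d ∸ 2 ≤ excessDegree T) deg≡Δ (deg∸2≤excessDegree T c)))
  bound : suc k * (Δ ∸ 1) ≤ TW T
  bound = ≤-trans (*-monoʳ-≤ (suc k) Δ∸1≤) (TW-bound k T tree)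
  to : TW T ≡ suc k * (Δ ∸ 1) → Starlike T Δ
  to e = c , deg≡Δ , 3≤deg-c , λ w 3≤w → amo w c 3≤w 3≤deg-c
    where
    amo : AtMostOneBranching T
    amo = Equivalence.to (TW-tight k T tree)
            (≤-antisym (subst (_≤ suc k * suc (excessDegree T)) (sym e) (*-monoʳ-≤ (suc k) Δ∸1≤)) (TW-bound k T tree))
  from : Starlike T Δ → TW T ≡ suc k * (Δ ∸ 1)
  from starlike@(v , deg-v , _ , _) =
    trans (Equivalence.from (TW-tight k T tree) (branchingOnlyAt⇒atMostOneBranching T v only))
          (cong (suc k *_) (trans (cong suc (trans (branchingOnlyAt⇒excessDegree T v only) (cong (_∸ 2) deg-v))) suc[Δ∸2]≡Δ∸1))
    where
    only : BranchingOnlyAt T v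
    only = starlike⇒branchingOnlyAt T starlike
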